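{- Let $\mathcal M(x,u)=\sum_{n,k\ge0}|\mathcal M_{n,k}|x^nu^k$ and $\mathbf M(x,u)=\sum_{n,k\ge 0}x^nu^k\sum_{p\in\mathcal M_{n,k}} d(p)$. Then \[\mathbf M(x,u)=x(1+u)\mathbf M(x,u)+ux^2\Big(2\mathcal M(x,u)\mathbf M(x,u)+\mathcal M(x,u)\,\tfrac{\partial}{\partial x}\big(x\mathcal M(x,u)\big)\Big),\] and explicitly \[\mathbf M(x,u) = \frac{\left(u^2+1\right) x^2-(u+1) x+((u +1)x-1) \left(\sqrt{(u-1)^2 x^2-2 (u+1) x+1}-1\right)}{2 u x^2 \left((u-1)^2 x^2-2 (u+1) x+1\right)}.\]
   Context: Steps: $U=(1,1)$, $D=(1,-1)$, and two distinguishable horizontal steps $O_1,O_2$, each $(1,0)$. $\mathcal M_{n,k}$ is the set of lattice paths from $(0,0)$ to $(n,0)$ with steps in $\{U,D,O_1,O_2\}$, staying weakly above the $x$-axis, with exactly $k$ steps of type $U$ or $O_1$. For such a path $p$ with heights $p_0,\dots,p_n$ after $0,\dots,n$ steps, $d(p)=\sum_{i=0}^n|p_i|$ (area under the path). -}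

module Defs where

open import Data.Nat as ℕ using (ℕ; zero; suc; _∸_)
open import Data.Bool using (Bool; true; false; _∧_; _∨_; if_then_else_)
open import Data.List using (List; []; _∷_; map; concatMap; filter; length; upTo)
open import Data.Nat.ListAction using (sum)
open import Data.Vec using (Vec; []; _∷_)
open import Data.Integer as ℤ using (ℤ; +_)
open import Relation.Binary.PropositionalEquality using (_≡_)
open import Relation.Nullary.Decidable using (⌊_⌋)
open import Data.Bool.Properties using (T?)
open import Data.Product using (_×_)
import Data.List

-- The four step types: U = (1,1), D = (1,-1), O1, O2 = (1,0)
data Step : Set where
  U D O₁ O₂ : Step

allSteps : List Step
allSteps = U ∷ D ∷ O₁ ∷ O₂ ∷ []

allWords : (n : ℕ) → List (Vec Step n)
allWords zero    = [] ∷ []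
allWords (suc n) = concatMap (λ s → map (s ∷_) (allWords n)) allSteps

validFrom : ℕ → {n : ℕ} → Vec Step n → Bool
validFrom h       []       = h ℕ.≡ᵇ 0
validFrom h       (U ∷ w)  = validFrom (suc h) w
validFrom zero    (D ∷ w)  = false
validFrom (suc h) (D ∷ w)  = validFrom h w
validFrom h       (O₁ ∷ w) = validFrom h w
validFrom h       (O₂ ∷ w) = validFrom h w

isUO₁ : Step → Bool
isUO₁ U  = true
isUO₁ O₁ = true
isUO₁ _  = false

countUO₁ : {n : ℕ} → Vec Step n → ℕ
countUO₁ []      = 0
countUO₁ (s ∷ w) = (if isUO₁ s then 1 else 0) ℕ.+ countUO₁ w

-- height after one step (only used on valid paths; D from 0 truncates, never happens)
stepH : Step → ℕ → ℕ
stepH U  h = suc h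
stepH D  h = h ∸ 1
stepH O₁ h = h
stepH O₂ h = h

areaFrom : ℕ → {n : ℕ} → Vec Step n → ℕ
areaFrom h []      = h
areaFrom h (s ∷ w) = h ℕ.+ areaFrom (stepH s h) w

area : {n : ℕ} → Vec Step n → ℕ
area = areaFrom 0

inM : (n k : ℕ) → Vec Step n → Bool
inM n k w = validFrom 0 w ∧ (countUO₁ w ℕ.≡ᵇ k)

Mset : (n k : ℕ) → List (Vec Step n)
Mset n k = filter (λ w → T? (inM n k w)) (allWords n)

card : ℕ → ℕ → ℕ
card n k = length (Mset n k)

totalArea : ℕ → ℕ → ℕ
totalArea n k = sum (map area (Mset n k))

-- Formal power series in x, u over ℤ: f n k = [x^n u^k] f

Series : Set
Series = ℕ → ℕ → ℤ

_≋_ : Series → Series → Set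
f ≋ g = ∀ n k → f n k ≡ g n k

infix 4 _≋_
infixl 6 _⊕_ _⊖_
infixl 7 _⊛_

_⊕_ : Series → Series → Series
(f ⊕ g) n k = f n k ℤ.+ g n k

_⊖_ : Series → Series → Series
(f ⊖ g) n k = f n k ℤ.- g n k

_⊛_ : Series → Series → Series
(f ⊛ g) n k =
  Data.List.foldr ℤ._+_ (+ 0)
    (concatMap (λ i → map (λ j → f i j ℤ.* g (n ∸ i) (k ∸ j)) (upTo (suc k))) (upTo (suc n)))

const : ℤ → Series
const c zero zero = c
const c _    _    = + 0

𝟙 : Series
𝟙 = const (+ 1)

X : Series
X (suc zero) zero = + 1
X _          _    = + 0

Uv : Series
Uv zero (suc zero) = + 1
Uv _    _          = + 0

∂x : Series → Series
∂x f n k = + (suc n) ℤ.* f (suc n) k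

𝓜 : Series
𝓜 n k = + card n k

𝐌 : Series
𝐌 n k = + totalArea n k

Δ : Series
Δ = (Uv ⊖ 𝟙) ⊛ (Uv ⊖ 𝟙) ⊛ X ⊛ X ⊖ const (+ 2) ⊛ (Uv ⊕ 𝟙) ⊛ X ⊕ 𝟙

-- a square root of Δ with constant term 1 (the branch of √Δ as a power series)
IsSqrtΔ : Series → Set
IsSqrtΔ S = (S ⊛ S ≋ Δ) × (S 0 0 ≡ + 1)

-- Write 𝓜[ h ] and 𝐌[ h ] for the generating functions of the paths that start at height h and
-- end on the axis, counted and weighted by area, so that 𝓜 = 𝓜[ 0 ] and 𝐌 = 𝐌[ 0 ]. Splitting off
-- the first step expresses each of them through the same family at heights h - 1, h, h + 1.
-- Splitting at the first visit to height h gives 𝓜[ h + 1 ] = x 𝓜 𝓜[ h ] and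
-- 𝐌[ h + 1 ] = x (𝐌 𝓜[ h ] + 𝓜 𝐌[ h ] + (h + 1) ∂(x𝓜)/∂x 𝓜[ h ]); instead of constructing the
-- bijection, we check that the defects of these identities satisfy a recursion that makes them
-- divisible by every power of x. At h = 0 this yields 𝓜 = 1 + x ((1 + u) 𝓜 + u x 𝓜²), so
-- √Δ = 1 - x (1 + u) - 2 u x² 𝓜 is the square root of Δ with constant term 1 (such a root is
-- unique), and applying x ∂/∂x gives ∂(x𝓜)/∂x ⋅ √Δ = 𝓜. The functional equation for 𝐌 is the
-- first-step equation at h = 0 with 𝐌[ 1 ] substituted, and the closed form follows from it by
-- eliminating 𝓜 and ∂(x𝓜)/∂x with the last two identities.
module Submission where

open import Defs
open import Data.Product using (_×_; _,_; proj₁; proj₂)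
open import Data.Integer using (+_)

open import Algebra.Bundles using (CommutativeRing)
import Algebra.Solver.Ring as RingSolver
open import Algebra.Solver.Ring.AlmostCommutativeRing
  using (fromCommutativeRing; _-Raw-AlmostCommutative⟶_; Induced-equivalence)
open import Data.Bool using (Bool; true; false; _∧_; if_then_else_)
open import Data.Bool.Properties using (∧-zeroʳ; T?)
open import Data.Empty using (⊥-elim)
open import Data.Fin using (toℕ)
import Data.Fin.Properties as Fin
open import Data.Integer as ℤ using (ℤ; +0; _+_; _*_; -_; _-_)
import Data.Integer.Properties as ℤ
open import Data.List as List using (List; []; _∷_; _++_)
import Data.List.Properties as List
open import Data.Maybe using (just; nothing)
open import Data.Nat as ℕ using (ℕ; zero; suc; _∸_; z≤n; s≤s)
import Data.Nat.Properties as ℕ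
open import Data.Nat.ListAction using (sum)
open import Data.Sum using ([_,_]′)
open import Data.Vec using (Vec; []; _∷_)
open import Data.Vec.N-ary using (N-ary; Eq; curryⁿ; curryⁿ-cong; Eq-to-Eqʰ)
open import Function using (_∘_; id; case_of_)
open import Level using (0ℓ)
open import Relation.Binary.Definitions using (WeaklyDecidable)
open import Relation.Binary.PropositionalEquality hiding (setoid)
import Relation.Binary.Reasoning.Setoid as SetoidReasoning
open import Relation.Nullary using (¬_; yes; no)

import Algebra.Construct.Pointwise ℕ as Pointwise
open import Algebra.Properties.CommutativeSemigroup ℤ.*-commutativeSemigroup
  using () renaming (x∙yz≈y∙xz to x*[y*z]≡y*[x*z])
open import Algebra.Properties.CommutativeSemigroup ℤ.+-commutativeSemigroup
  using () renaming (x∙yz≈y∙xz to x+[y+z]≡y+[x+z])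
open import Algebra.Properties.Semiring.Sum ℤ.+-*-semiring
  using (∑-distrib-+; ∑-comm; *-distribˡ-sum; *-distribʳ-sum; sum-cong-≗) renaming (sum to sumᵛ)

-- Finite sums

-- Opaque, so that unification sees ∑ m h rather than an unfolded vector fold.
opaque
  ∑ : ℕ → (ℕ → ℤ) → ℤ
  ∑ m h = sumᵛ {m} (h ∘ toℕ)

  ∑-empty : ∀ (h : ℕ → ℤ) → ∑ 0 h ≡ +0
  ∑-empty h = refl

  ∑-suc : ∀ m (h : ℕ → ℤ) → ∑ (suc m) h ≡ h 0 + ∑ m (h ∘ suc)
  ∑-suc m h = refl

  ∑-cong : ∀ m {h h′ : ℕ → ℤ} → (∀ i → i ℕ.< m → h i ≡ h′ i) → ∑ m h ≡ ∑ m h′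
  ∑-cong m eq = sum-cong-≗ (λ i → eq (toℕ i) (Fin.toℕ<n i))

  ∑-+ : ∀ m (h h′ : ℕ → ℤ) → ∑ m (λ i → h i + h′ i) ≡ ∑ m h + ∑ m h′
  ∑-+ m h h′ = ∑-distrib-+ {m} (h ∘ toℕ) (h′ ∘ toℕ)

  ∑-*ˡ : ∀ m c (h : ℕ → ℤ) → c * ∑ m h ≡ ∑ m (λ i → c * h i)
  ∑-*ˡ m c h = *-distribˡ-sum {m} c (h ∘ toℕ)

  ∑-*ʳ : ∀ m c (h : ℕ → ℤ) → ∑ m h * c ≡ ∑ m (λ i → h i * c)
  ∑-*ʳ m c h = *-distribʳ-sum {m} c (h ∘ toℕ)

  ∑-swap : ∀ m p (a : ℕ → ℕ → ℤ) → ∑ m (λ i → ∑ p (a i)) ≡ ∑ p (λ j → ∑ m (λ i → a i j))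
  ∑-swap m p a = ∑-comm {m} {p} (λ i j → a (toℕ i) (toℕ j))

syntax ∑ m (λ i → x) = ∑[ i < m ] x

∑-cong′ : ∀ m {h h′ : ℕ → ℤ} → (∀ i → h i ≡ h′ i) → ∑ m h ≡ ∑ m h′
∑-cong′ m eq = ∑-cong m (λ i _ → eq i)

∑-zero : ∀ m {h : ℕ → ℤ} → (∀ i → i ℕ.< m → h i ≡ +0) → ∑ m h ≡ +0
∑-zero zero    {h} eq = ∑-empty h
∑-zero (suc m) {h} eq = trans (∑-suc m h)
  (cong₂ _+_ (eq 0 (s≤s z≤n)) (∑-zero m (λ i i<m → eq (suc i) (s≤s i<m))))

∑-one : ∀ (h : ℕ → ℤ) → ∑ 1 h ≡ h 0
∑-one h = trans (∑-suc 0 h) (trans (cong (_+_ (h 0)) (∑-empty (h ∘ suc))) (ℤ.+-identityʳ (h 0)))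

∑-last : ∀ m (h : ℕ → ℤ) → ∑ (suc m) h ≡ ∑ m h + h m
∑-last zero    h = trans (∑-one h) (sym (trans (cong (_+ h 0) (∑-empty h)) (ℤ.+-identityˡ (h 0))))
∑-last (suc m) h = begin
  ∑ (suc (suc m)) h               ≡⟨ ∑-suc (suc m) h ⟩
  h 0 + ∑ (suc m) (h ∘ suc)        ≡⟨ cong (_+_ (h 0)) (∑-last m (h ∘ suc)) ⟩
  h 0 + (∑ m (h ∘ suc) + h (suc m)) ≡⟨ ℤ.+-assoc (h 0) _ _ ⟨
  (h 0 + ∑ m (h ∘ suc)) + h (suc m) ≡⟨ cong (_+ h (suc m)) (∑-suc m h) ⟨
  ∑ (suc m) h + h (suc m)          ∎
  where open ≡-Reasoning

∑-reverse : ∀ n (h : ℕ → ℤ) → ∑[ i < suc n ] h (n ∸ i) ≡ ∑ (suc n) h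
∑-reverse zero    h = trans (∑-one (λ i → h (0 ∸ i))) (sym (∑-one h))
∑-reverse (suc n) h = begin
  ∑[ i < suc (suc n) ] h (suc n ∸ i)   ≡⟨ ∑-suc (suc n) (λ i → h (suc n ∸ i)) ⟩
  h (suc n) + ∑[ i < suc n ] h (n ∸ i) ≡⟨ cong (_+_ (h (suc n))) (∑-reverse n h) ⟩
  h (suc n) + ∑ (suc n) h              ≡⟨ ℤ.+-comm (h (suc n)) _ ⟩
  ∑ (suc n) h + h (suc n)              ≡⟨ ∑-last (suc n) h ⟨
  ∑ (suc (suc n)) h                    ∎
  where open ≡-Reasoning

∑-single : ∀ m t (h : ℕ → ℤ) → t ℕ.< m → (∀ i → i ℕ.< m → ¬ i ≡ t → h i ≡ +0) → ∑ m h ≡ h t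
∑-single (suc m) zero    h _ others = begin
  ∑ (suc m) h          ≡⟨ ∑-suc m h ⟩
  h 0 + ∑ m (h ∘ suc) ≡⟨ cong (_+_ (h 0)) (∑-zero m λ i i<m → others (suc i) (s≤s i<m) λ ()) ⟩
  h 0 + +0            ≡⟨ ℤ.+-identityʳ (h 0) ⟩
  h 0                 ∎
  where open ≡-Reasoning
∑-single (suc m) (suc t) h (s≤s t<m) others = begin
  ∑ (suc m) h          ≡⟨ ∑-suc m h ⟩
  h 0 + ∑ m (h ∘ suc) ≡⟨ cong (_+ ∑ m (h ∘ suc)) (others 0 (s≤s z≤n) λ ()) ⟩
  +0 + ∑ m (h ∘ suc)  ≡⟨ ℤ.+-identityˡ _ ⟩
  ∑ m (h ∘ suc)       ≡⟨ ∑-single m t (h ∘ suc) t<m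
                           (λ i i<m i≢t → others (suc i) (s≤s i<m) (i≢t ∘ ℕ.suc-injective)) ⟩
  h (suc t)           ∎
  where open ≡-Reasoning

-- Reindexing the triangle i + t ≤ n by the anti-diagonals s = i + t.
∑-triangle : ∀ n (a : ℕ → ℕ → ℤ) →
  ∑[ i < suc n ] ∑[ t < suc (n ∸ i) ] a i t ≡ ∑[ s < suc n ] ∑[ i < suc s ] a i (s ∸ i)
∑-triangle zero    a = trans (∑-one _) (trans (∑-one (a 0)) (sym (trans (∑-one _) (∑-one _))))
∑-triangle (suc n) a = begin
  ∑[ i < suc (suc n) ] ∑[ t < suc (suc n ∸ i) ] a i t
    ≡⟨ ∑-last (suc n) (λ i → ∑[ t < suc (suc n ∸ i) ] a i t) ⟩
  ∑[ i < suc n ] ∑[ t < suc (suc n ∸ i) ] a i t + ∑[ t < suc (n ∸ n) ] a (suc n) t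
    ≡⟨ cong₂ _+_ rows lastRow ⟩
  (∑[ i < suc n ] ∑[ t < suc (n ∸ i) ] a i t + ∑[ i < suc n ] a i (suc (n ∸ i))) + a (suc n) 0
    ≡⟨ ℤ.+-assoc (∑[ i < suc n ] ∑[ t < suc (n ∸ i) ] a i t) (∑[ i < suc n ] a i (suc (n ∸ i)))
                 (a (suc n) 0) ⟩
  ∑[ i < suc n ] ∑[ t < suc (n ∸ i) ] a i t + (∑[ i < suc n ] a i (suc (n ∸ i)) + a (suc n) 0)
    ≡⟨ cong₂ _+_ (∑-triangle n a) lastDiagonal ⟩
  ∑[ s < suc n ] ∑[ i < suc s ] a i (s ∸ i) + ∑[ i < suc (suc n) ] a i (suc n ∸ i)
    ≡⟨ ∑-last (suc n) (λ s → ∑[ i < suc s ] a i (s ∸ i)) ⟨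
  ∑[ s < suc (suc n) ] ∑[ i < suc s ] a i (s ∸ i)
    ∎
  where
  open ≡-Reasoning
  suc-∸ : ∀ i → i ℕ.< suc n → suc n ∸ i ≡ suc (n ∸ i)
  suc-∸ i (s≤s i≤n) = ℕ.+-∸-assoc 1 i≤n
  rows : ∑[ i < suc n ] ∑[ t < suc (suc n ∸ i) ] a i t
       ≡ ∑[ i < suc n ] ∑[ t < suc (n ∸ i) ] a i t + ∑[ i < suc n ] a i (suc (n ∸ i))
  rows = trans (∑-cong (suc n) λ i i≤n →
                  trans (cong (λ m → ∑ (suc m) (a i)) (suc-∸ i i≤n)) (∑-last (suc (n ∸ i)) (a i)))
               (∑-+ (suc n) (λ i → ∑[ t < suc (n ∸ i) ] a i t) (λ i → a i (suc (n ∸ i))))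
  lastRow : ∑[ t < suc (n ∸ n) ] a (suc n) t ≡ a (suc n) 0
  lastRow rewrite ℕ.n∸n≡0 n = ∑-one (a (suc n))
  lastDiagonal : ∑[ i < suc n ] a i (suc (n ∸ i)) + a (suc n) 0 ≡ ∑[ i < suc (suc n) ] a i (suc n ∸ i)
  lastDiagonal = sym (trans (∑-last (suc n) (λ i → a i (suc n ∸ i)))
    (cong₂ _+_ (∑-cong (suc n) λ i i≤n → cong (a i) (suc-∸ i i≤n)) (cong (a (suc n)) (ℕ.n∸n≡0 n))))

listSum : List ℤ → ℤ
listSum = List.foldr _+_ +0

listSum-++ : ∀ xs ys → listSum (xs ++ ys) ≡ listSum xs + listSum ys
listSum-++ []       ys = sym (ℤ.+-identityˡ (listSum ys))
listSum-++ (x ∷ xs) ys = trans (cong (_+_ x) (listSum-++ xs ys)) (sym (ℤ.+-assoc x _ _))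

listSum-concatMap : ∀ {A : Set} (F : A → List ℤ) xs →
  listSum (List.concatMap F xs) ≡ listSum (List.map (listSum ∘ F) xs)
listSum-concatMap F []       = refl
listSum-concatMap F (x ∷ xs) =
  trans (listSum-++ (F x) (List.concatMap F xs)) (cong (_+_ (listSum (F x))) (listSum-concatMap F xs))

listSum-upTo : ∀ (h : ℕ → ℤ) m → listSum (List.map h (List.upTo m)) ≡ ∑ m h
listSum-upTo h m = trans (cong listSum (List.map-upTo h m)) (applyUpTo h m)
  where
  applyUpTo : ∀ (h : ℕ → ℤ) m → listSum (List.applyUpTo h m) ≡ ∑ m h
  applyUpTo h zero    = sym (∑-empty h)
  applyUpTo h (suc m) = trans (cong (_+_ (h 0)) (applyUpTo (h ∘ suc) m)) (sym (∑-suc m h))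

sumMap : ∀ {A : Set} → (A → ℤ) → List A → ℤ
sumMap f xs = listSum (List.map f xs)

sumMap-cong : ∀ {A : Set} {f g : A → ℤ} xs → (∀ x → f x ≡ g x) → sumMap f xs ≡ sumMap g xs
sumMap-cong xs f≗g = cong listSum (List.map-cong f≗g xs)

sumMap-zero : ∀ {A : Set} {f : A → ℤ} xs → (∀ x → f x ≡ +0) → sumMap f xs ≡ +0
sumMap-zero []       f≗0 = refl
sumMap-zero (x ∷ xs) f≗0 = cong₂ _+_ (f≗0 x) (sumMap-zero xs f≗0)

sumMap-affine : ∀ {A : Set} c (f g : A → ℤ) xs →
  sumMap (λ x → c * f x + g x) xs ≡ c * sumMap f xs + sumMap g xs
sumMap-affine c f g []       = sym (trans (ℤ.+-identityʳ (c * +0)) (ℤ.*-zeroʳ c))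
sumMap-affine c f g (x ∷ xs) = begin
  (c * f x + g x) + sumMap (λ x → c * f x + g x) xs ≡⟨ cong (_+_ (c * f x + g x)) (sumMap-affine c f g xs) ⟩
  (c * f x + g x) + (c * F + G)                    ≡⟨ ℤ.+-assoc (c * f x) (g x) _ ⟩
  c * f x + (g x + (c * F + G))                    ≡⟨ cong (_+_ (c * f x)) (x+[y+z]≡y+[x+z] (g x) (c * F) G) ⟩
  c * f x + (c * F + (g x + G))                    ≡⟨ ℤ.+-assoc (c * f x) (c * F) _ ⟨
  (c * f x + c * F) + (g x + G)                    ≡⟨ cong (_+ (g x + G)) (ℤ.*-distribˡ-+ c (f x) F) ⟨
  c * (f x + F) + (g x + G)                        ∎
  where
  open ≡-Reasoning
  F = sumMap f xs
  G = sumMap g xs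

sumMap-concatMap : ∀ {A B : Set} (f : B → ℤ) (F : A → List B) xs →
  sumMap f (List.concatMap F xs) ≡ sumMap (sumMap f ∘ F) xs
sumMap-concatMap f F xs =
  trans (cong listSum (List.map-concatMap f F xs)) (listSum-concatMap (List.map f ∘ F) xs)

+length-filter : ∀ {A : Set} (P : A → Bool) xs →
  + List.length (List.filter (T? ∘ P) xs) ≡ sumMap (λ x → if P x then + 1 else +0) xs
+length-filter P []       = refl
+length-filter P (x ∷ xs) with P x
... | true  = cong (_+_ (+ 1)) (+length-filter P xs)
... | false = trans (+length-filter P xs) (sym (ℤ.+-identityˡ _))

+sum-filter : ∀ {A : Set} (P : A → Bool) (f : A → ℕ) xs →
  + sum (List.map f (List.filter (T? ∘ P) xs)) ≡ sumMap (λ x → if P x then + f x else +0) xs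
+sum-filter P f []       = refl
+sum-filter P f (x ∷ xs) with P x
... | true  = cong (_+_ (+ f x)) (+sum-filter P f xs)
... | false = trans (+sum-filter P f xs) (sym (ℤ.+-identityˡ _))

-- The ring of formal power series

⊛-coeff : ∀ f g n k → (f ⊛ g) n k ≡ ∑[ i < suc n ] ∑[ j < suc k ] (f i j * g (n ∸ i) (k ∸ j))
⊛-coeff f g n k =
  trans (listSum-concatMap row (List.upTo (suc n)))
  (trans (listSum-upTo (listSum ∘ row) (suc n))
         (∑-cong′ (suc n) λ i → listSum-upTo (λ j → f i j * g (n ∸ i) (k ∸ j)) (suc k)))
  where
  row : ℕ → List ℤ
  row i = List.map (λ j → f i j * g (n ∸ i) (k ∸ j)) (List.upTo (suc k))

⊛-comm : ∀ f g → f ⊛ g ≋ g ⊛ f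
⊛-comm f g n k = begin
  (f ⊛ g) n k
    ≡⟨ ⊛-coeff f g n k ⟩
  ∑[ i < suc n ] ∑[ j < suc k ] (f i j * g (n ∸ i) (k ∸ j))
    ≡⟨ ∑-reverse n (λ i → ∑[ j < suc k ] (f i j * g (n ∸ i) (k ∸ j))) ⟨
  ∑[ i < suc n ] ∑[ j < suc k ] (f (n ∸ i) j * g (n ∸ (n ∸ i)) (k ∸ j))
    ≡⟨ ∑-cong′ (suc n) (λ i → ∑-reverse k (λ j → f (n ∸ i) j * g (n ∸ (n ∸ i)) (k ∸ j))) ⟨
  ∑[ i < suc n ] ∑[ j < suc k ] (f (n ∸ i) (k ∸ j) * g (n ∸ (n ∸ i)) (k ∸ (k ∸ j)))
    ≡⟨ ∑-cong (suc n) (λ i i<1+n → ∑-cong (suc k) λ j j<1+k →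
         trans (ℤ.*-comm (f (n ∸ i) (k ∸ j)) _)
               (cong₂ (λ a b → g a b * f (n ∸ i) (k ∸ j)) (ℕ.m∸[m∸n]≡n (ℕ.m<1+n⇒m≤n i<1+n))
                                                           (ℕ.m∸[m∸n]≡n (ℕ.m<1+n⇒m≤n j<1+k)))) ⟩
  ∑[ i < suc n ] ∑[ j < suc k ] (g i j * f (n ∸ i) (k ∸ j))
    ≡⟨ ⊛-coeff g f n k ⟨
  (g ⊛ f) n k
    ∎
  where open ≡-Reasoning

⊛-cong : ∀ {f f′ g g′} → f ≋ f′ → g ≋ g′ → f ⊛ g ≋ f′ ⊛ g′
⊛-cong {f} {f′} {g} {g′} f≋f′ g≋g′ n k = begin
  (f ⊛ g) n k
    ≡⟨ ⊛-coeff f g n k ⟩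
  ∑[ i < suc n ] ∑[ j < suc k ] (f i j * g (n ∸ i) (k ∸ j))
    ≡⟨ ∑-cong′ (suc n) (λ i → ∑-cong′ (suc k) λ j → cong₂ _*_ (f≋f′ i j) (g≋g′ (n ∸ i) (k ∸ j))) ⟩
  ∑[ i < suc n ] ∑[ j < suc k ] (f′ i j * g′ (n ∸ i) (k ∸ j))
    ≡⟨ ⊛-coeff f′ g′ n k ⟨
  (f′ ⊛ g′) n k
    ∎
  where open ≡-Reasoning

⊛-distribˡ : ∀ f g h → f ⊛ (g ⊕ h) ≋ f ⊛ g ⊕ f ⊛ h
⊛-distribˡ f g h n k = begin
  (f ⊛ (g ⊕ h)) n k
    ≡⟨ ⊛-coeff f (g ⊕ h) n k ⟩
  ∑[ i < suc n ] ∑[ j < suc k ] (f i j * (g (n ∸ i) (k ∸ j) + h (n ∸ i) (k ∸ j)))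
    ≡⟨ ∑-cong′ (suc n) (λ i → trans (∑-cong′ (suc k) λ j → ℤ.*-distribˡ-+ (f i j) _ _)
                                    (∑-+ (suc k) (λ j → f i j * g (n ∸ i) (k ∸ j))
                                                 (λ j → f i j * h (n ∸ i) (k ∸ j)))) ⟩
  ∑[ i < suc n ] (∑[ j < suc k ] (f i j * g (n ∸ i) (k ∸ j)) + ∑[ j < suc k ] (f i j * h (n ∸ i) (k ∸ j)))
    ≡⟨ ∑-+ (suc n) _ _ ⟩
  ∑[ i < suc n ] ∑[ j < suc k ] (f i j * g (n ∸ i) (k ∸ j))
    + ∑[ i < suc n ] ∑[ j < suc k ] (f i j * h (n ∸ i) (k ∸ j))
    ≡⟨ cong₂ _+_ (⊛-coeff f g n k) (⊛-coeff f h n k) ⟨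
  (f ⊛ g ⊕ f ⊛ h) n k
    ∎
  where open ≡-Reasoning

const-⊛ : ∀ c f n k → (const c ⊛ f) n k ≡ c * f n k
const-⊛ c f n k = begin
  (const c ⊛ f) n k
    ≡⟨ ⊛-coeff (const c) f n k ⟩
  ∑[ i < suc n ] ∑[ j < suc k ] (const c i j * f (n ∸ i) (k ∸ j))
    ≡⟨ ∑-single (suc n) 0 _ (s≤s z≤n) (λ where
         zero    _ 0≢0 → ⊥-elim (0≢0 refl)
         (suc i) _ _   → ∑-zero (suc k) λ _ _ → refl) ⟩
  ∑[ j < suc k ] (const c 0 j * f n (k ∸ j))
    ≡⟨ ∑-single (suc k) 0 _ (s≤s z≤n) (λ where
         zero    _ 0≢0 → ⊥-elim (0≢0 refl)
         (suc j) _ _   → refl) ⟩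
  c * f n k
    ∎
  where open ≡-Reasoning

⊛-assoc : ∀ f g h → (f ⊛ g) ⊛ h ≋ f ⊛ (g ⊛ h)
⊛-assoc f g h n k = trans byProductFirst (sym byProductLast)
  where
  open ≡-Reasoning
  term : ℕ → ℕ → ℕ → ℕ → ℤ
  term s i t b = f i b * g (s ∸ i) (t ∸ b) * h (n ∸ s) (k ∸ t)
  diagonalSum : ℤ
  diagonalSum = ∑[ s < suc n ] ∑[ i < suc s ] ∑[ t < suc k ] ∑[ b < suc t ] term s i t b
  byProductFirst : ((f ⊛ g) ⊛ h) n k ≡ diagonalSum
  byProductFirst = begin
    ((f ⊛ g) ⊛ h) n k
      ≡⟨ ⊛-coeff (f ⊛ g) h n k ⟩
    ∑[ s < suc n ] ∑[ t < suc k ] ((f ⊛ g) s t * h (n ∸ s) (k ∸ t))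
      ≡⟨ ∑-cong′ (suc n) (λ s → ∑-cong′ (suc k) λ t → begin
           (f ⊛ g) s t * h (n ∸ s) (k ∸ t)
             ≡⟨ cong (_* h (n ∸ s) (k ∸ t)) (⊛-coeff f g s t) ⟩
           ∑[ i < suc s ] ∑[ b < suc t ] (f i b * g (s ∸ i) (t ∸ b)) * h (n ∸ s) (k ∸ t)
             ≡⟨ ∑-*ʳ (suc s) (h (n ∸ s) (k ∸ t)) _ ⟩
           ∑[ i < suc s ] (∑[ b < suc t ] (f i b * g (s ∸ i) (t ∸ b)) * h (n ∸ s) (k ∸ t))
             ≡⟨ ∑-cong′ (suc s) (λ i → ∑-*ʳ (suc t) (h (n ∸ s) (k ∸ t)) _) ⟩
           ∑[ i < suc s ] ∑[ b < suc t ] term s i t b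
             ∎) ⟩
    ∑[ s < suc n ] ∑[ t < suc k ] ∑[ i < suc s ] ∑[ b < suc t ] term s i t b
      ≡⟨ ∑-cong′ (suc n) (λ s → ∑-swap (suc k) (suc s) _) ⟩
    diagonalSum
      ∎
  byProductLast : (f ⊛ (g ⊛ h)) n k ≡ diagonalSum
  byProductLast = begin
    (f ⊛ (g ⊛ h)) n k
      ≡⟨ ⊛-coeff f (g ⊛ h) n k ⟩
    ∑[ i < suc n ] ∑[ b < suc k ] (f i b * (g ⊛ h) (n ∸ i) (k ∸ b))
      ≡⟨ ∑-cong′ (suc n) (λ i → trans (∑-cong′ (suc k) λ b → begin
           f i b * (g ⊛ h) (n ∸ i) (k ∸ b)
             ≡⟨ cong (_*_ (f i b)) (⊛-coeff g h (n ∸ i) (k ∸ b)) ⟩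
           f i b * ∑[ c < suc (n ∸ i) ] ∑[ d < suc (k ∸ b) ] (g c d * h (n ∸ i ∸ c) (k ∸ b ∸ d))
             ≡⟨ ∑-*ˡ (suc (n ∸ i)) (f i b) _ ⟩
           ∑[ c < suc (n ∸ i) ] (f i b * ∑[ d < suc (k ∸ b) ] (g c d * h (n ∸ i ∸ c) (k ∸ b ∸ d)))
             ≡⟨ ∑-cong′ (suc (n ∸ i)) (λ c → ∑-*ˡ (suc (k ∸ b)) (f i b) _) ⟩
           ∑[ c < suc (n ∸ i) ] ∑[ d < suc (k ∸ b) ] (f i b * (g c d * h (n ∸ i ∸ c) (k ∸ b ∸ d)))
             ∎)
           (∑-swap (suc k) (suc (n ∸ i)) _)) ⟩
    ∑[ i < suc n ] ∑[ c < suc (n ∸ i) ] ∑[ b < suc k ] ∑[ d < suc (k ∸ b) ]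
      (f i b * (g c d * h (n ∸ i ∸ c) (k ∸ b ∸ d)))
      ≡⟨ ∑-triangle n _ ⟩
    ∑[ s < suc n ] ∑[ i < suc s ] ∑[ b < suc k ] ∑[ d < suc (k ∸ b) ]
      (f i b * (g (s ∸ i) d * h (n ∸ i ∸ (s ∸ i)) (k ∸ b ∸ d)))
      ≡⟨ ∑-cong′ (suc n) (λ s → ∑-cong′ (suc s) λ i → ∑-triangle k _) ⟩
    ∑[ s < suc n ] ∑[ i < suc s ] ∑[ t < suc k ] ∑[ b < suc t ]
      (f i b * (g (s ∸ i) (t ∸ b) * h (n ∸ i ∸ (s ∸ i)) (k ∸ b ∸ (t ∸ b))))
      ≡⟨ ∑-cong′ (suc n) (λ s → ∑-cong (suc s) λ i i<1+s → ∑-cong′ (suc k) λ t → ∑-cong (suc t) λ b b<1+t →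
           trans (cong₂ (λ x y → f i b * (g (s ∸ i) (t ∸ b) * h x y))
                        (∸-∸-cancel n (ℕ.m<1+n⇒m≤n i<1+s)) (∸-∸-cancel k (ℕ.m<1+n⇒m≤n b<1+t)))
                 (sym (ℤ.*-assoc (f i b) _ _))) ⟩
    diagonalSum
      ∎
    where
    ∸-∸-cancel : ∀ m {i s} → i ℕ.≤ s → m ∸ i ∸ (s ∸ i) ≡ m ∸ s
    ∸-∸-cancel m {i} {s} i≤s = trans (ℕ.∸-+-assoc m i (s ∸ i)) (cong (m ∸_) (ℕ.m+[n∸m]≡n i≤s))

⊛-identityˡ : ∀ f → 𝟙 ⊛ f ≋ f
⊛-identityˡ f n k = trans (const-⊛ (+ 1) f n k) (ℤ.*-identityˡ (f n k))

0ₛ : Series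
0ₛ _ _ = +0

const-+0 : const +0 ≋ 0ₛ
const-+0 zero    zero    = refl
const-+0 zero    (suc k) = refl
const-+0 (suc n) k       = refl

-ₛ_ : Series → Series
(-ₛ f) n k = - f n k

seriesRing : CommutativeRing 0ℓ 0ℓ
seriesRing = record
  { Carrier = Series
  ; _≈_ = _≋_
  ; _+_ = _⊕_
  ; _*_ = _⊛_
  ; -_ = -ₛ_
  ; 0# = 0ₛ
  ; 1# = 𝟙
  ; isCommutativeRing = record
    { isRing = record
      { +-isAbelianGroup = Pointwise.isAbelianGroup (Pointwise.isAbelianGroup ℤ.+-0-isAbelianGroup)
      ; *-cong = ⊛-cong
      ; *-assoc = ⊛-assoc
      ; *-identity = ⊛-identityˡ , λ f → ≋-trans (⊛-comm f 𝟙) (⊛-identityˡ f)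
      ; distrib = ⊛-distribˡ , λ f g h → ≋-trans (⊛-comm (g ⊕ h) f) (≋-trans (⊛-distribˡ f g h)
                                           λ n k → cong₂ _+_ (⊛-comm f g n k) (⊛-comm f h n k))
      }
    ; *-comm = ⊛-comm
    }
  }
  where
  ≋-trans : ∀ {f g h} → f ≋ g → g ≋ h → f ≋ h
  ≋-trans f≋g g≋h n k = trans (f≋g n k) (g≋h n k)

open CommutativeRing seriesRing
  using (setoid)
  renaming (refl to ≋-refl; sym to ≋-sym; trans to ≋-trans; +-cong to ⊕-cong; +-identityˡ to ⊕-identityˡ;
            zeroˡ to ⊛-zeroˡ; zeroʳ to ⊛-zeroʳ)

const-homomorphism : CommutativeRing.rawRing ℤ.+-*-commutativeRing
                       -Raw-AlmostCommutative⟶ fromCommutativeRing seriesRing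
const-homomorphism = record
  { ⟦_⟧ = const
  ; +-homo = λ a b → λ { zero zero → refl ; zero (suc k) → refl ; (suc n) k → refl }
  ; *-homo = λ a b n k → trans (*-homo a b n k) (sym (const-⊛ a (const b) n k))
  ; -‿homo = λ a → λ { zero zero → refl ; zero (suc k) → refl ; (suc n) k → refl }
  ; 0-homo = const-+0
  ; 1-homo = λ _ _ → refl
  }
  where
  *-homo : ∀ a b n k → const (a * b) n k ≡ a * const b n k
  *-homo a b zero    zero    = refl
  *-homo a b zero    (suc k) = sym (ℤ.*-zeroʳ a)
  *-homo a b (suc n) k       = sym (ℤ.*-zeroʳ a)

const-≟ : WeaklyDecidable (Induced-equivalence const-homomorphism)
const-≟ a b with a ℤ.≟ b
... | yes refl = just λ _ _ → refl
... | no _     = nothing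

open RingSolver (CommutativeRing.rawRing ℤ.+-*-commutativeRing) (fromCommutativeRing seriesRing)
                const-homomorphism const-≟
  using (Polynomial; var; con; _:+_; _:*_; _:-_; :-_; _:=_; ⟦_⟧; ⟦_⟧↓; ⟦_⟧N; normalise; correct)
  renaming (solve to solveᵣ)
open import Relation.Binary.Reflection setoid var ⟦_⟧ ⟦_⟧↓ correct using (close)

-- The library solver needs the two normal forms to denote equal series, which Agda checks by
-- unfolding Cauchy products; requiring the normal forms themselves to coincide is far cheaper.
solve : ∀ n (f : N-ary n (Polynomial n) (Polynomial n × Polynomial n)) →
        normalise (proj₁ (close n f)) ≡ normalise (proj₂ (close n f)) →
        Eq n _≋_ (curryⁿ ⟦ proj₁ (close n f) ⟧) (curryⁿ ⟦ proj₂ (close n f) ⟧)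
solve n f same-normal-form = solveᵣ n f (Eq-to-Eqʰ n _≋_
  (curryⁿ-cong _≋_ ⟦ proj₁ (close n f) ⟧↓ ⟦ proj₂ (close n f) ⟧↓
     λ ρ i j → cong (λ p → ⟦ p ⟧N ρ i j) same-normal-form))

⊕-congˡ : ∀ f {g g′} → g ≋ g′ → f ⊕ g ≋ f ⊕ g′
⊕-congˡ f g≋g′ n k = cong (_+_ (f n k)) (g≋g′ n k)

⊛-congˡ : ∀ f {g g′} → g ≋ g′ → f ⊛ g ≋ f ⊛ g′
⊛-congˡ f {g} {g′} = ⊛-cong {f} {f} {g} {g′} ≋-refl

⊛-congʳ : ∀ g {f f′} → f ≋ f′ → f ⊛ g ≋ f′ ⊛ g
⊛-congʳ g {f} {f′} f≋f′ = ⊛-cong {f} {f′} {g} {g} f≋f′ ≋-refl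

-- To prove x ≋ y from hypotheses lᵢ ≋ rᵢ, exhibit a ring identity x = y + Σ aᵢ (lᵢ - rᵢ).
infixr 5 _·_∷_

data Combination : Series → Set where
  [_·_] : ∀ a {l r} → l ≋ r → Combination (a ⊛ (l ⊖ r))
  _·_∷_ : ∀ a {l r z} → l ≋ r → Combination z → Combination (a ⊛ (l ⊖ r) ⊕ z)

combination≋0ₛ : ∀ {z} → Combination z → z ≋ 0ₛ
combination≋0ₛ ([_·_] a {l} {r} l≋r) =
  ≋-trans (⊛-congˡ a λ n k → trans (cong (_- r n k) (l≋r n k)) (ℤ.+-inverseʳ (r n k))) (⊛-zeroʳ a)
combination≋0ₛ (a · l≋r ∷ rest) n k =
  cong₂ _+_ (combination≋0ₛ [ a · l≋r ] n k) (combination≋0ₛ rest n k)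

by-combination : ∀ {x y z} → x ≋ y ⊕ z → Combination z → x ≋ y
by-combination {x} {y} {z} x≋y+z combination n k =
  trans (x≋y+z n k) (trans (cong (_+_ (y n k)) (combination≋0ₛ combination n k)) (ℤ.+-identityʳ (y n k)))

-- The variables and the Euler operator x ∂/∂x

X⊛-zero : ∀ f k → (X ⊛ f) 0 k ≡ +0
X⊛-zero f k = trans (⊛-coeff X f 0 k) (∑-zero 1 λ where
  zero    _         → ∑-zero (suc k) λ _ _ → refl
  (suc i) (s≤s ()))

X⊛-suc : ∀ f n k → (X ⊛ f) (suc n) k ≡ f n k
X⊛-suc f n k = begin
  (X ⊛ f) (suc n) k
    ≡⟨ ⊛-coeff X f (suc n) k ⟩
  ∑[ i < suc (suc n) ] ∑[ j < suc k ] (X i j * f (suc n ∸ i) (k ∸ j))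
    ≡⟨ ∑-single (suc (suc n)) 1 _ (s≤s (s≤s z≤n)) (λ where
         zero          _ _   → ∑-zero (suc k) λ _ _ → refl
         (suc zero)    _ 1≢1 → ⊥-elim (1≢1 refl)
         (suc (suc i)) _ _   → ∑-zero (suc k) λ _ _ → refl) ⟩
  ∑[ j < suc k ] (X 1 j * f n (k ∸ j))
    ≡⟨ ∑-single (suc k) 0 _ (s≤s z≤n) (λ where
         zero    _ 0≢0 → ⊥-elim (0≢0 refl)
         (suc j) _ _   → refl) ⟩
  + 1 * f n k
    ≡⟨ ℤ.*-identityˡ (f n k) ⟩
  f n k
    ∎
  where open ≡-Reasoning

Uv⊛-zero : ∀ f n → (Uv ⊛ f) n 0 ≡ +0
Uv⊛-zero f n = trans (⊛-coeff Uv f n 0) (∑-zero (suc n) λ i _ → ∑-zero 1 λ where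
  zero    _         → Uv-i0 i
  (suc j) (s≤s ()))
  where
  Uv-i0 : ∀ i → Uv i 0 * f (n ∸ i) 0 ≡ +0
  Uv-i0 zero    = refl
  Uv-i0 (suc i) = refl

Uv⊛-suc : ∀ f n k → (Uv ⊛ f) n (suc k) ≡ f n k
Uv⊛-suc f n k = begin
  (Uv ⊛ f) n (suc k)
    ≡⟨ ⊛-coeff Uv f n (suc k) ⟩
  ∑[ i < suc n ] ∑[ j < suc (suc k) ] (Uv i j * f (n ∸ i) (suc k ∸ j))
    ≡⟨ ∑-single (suc n) 0 _ (s≤s z≤n) (λ where
         zero    _ 0≢0 → ⊥-elim (0≢0 refl)
         (suc i) _ _   → ∑-zero (suc (suc k)) λ _ _ → refl) ⟩
  ∑[ j < suc (suc k) ] (Uv 0 j * f n (suc k ∸ j))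
    ≡⟨ ∑-single (suc (suc k)) 1 _ (s≤s (s≤s z≤n)) (λ where
         zero          _ _   → refl
         (suc zero)    _ 1≢1 → ⊥-elim (1≢1 refl)
         (suc (suc j)) _ _   → refl) ⟩
  + 1 * f n k
    ≡⟨ ℤ.*-identityˡ (f n k) ⟩
  f n k
    ∎
  where open ≡-Reasoning

θ : Series → Series
θ f n k = + n * f n k

θ-cong : ∀ {f g} → f ≋ g → θ f ≋ θ g
θ-cong f≋g n k = cong (+ n *_) (f≋g n k)

θ-⊕ : ∀ f g → θ (f ⊕ g) ≋ θ f ⊕ θ g
θ-⊕ f g n k = ℤ.*-distribˡ-+ (+ n) (f n k) (g n k)

θ-𝟙 : θ 𝟙 ≋ 0ₛ
θ-𝟙 zero    k = refl
θ-𝟙 (suc n) k = ℤ.*-zeroʳ (+ suc n)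

θ-Leibniz : ∀ f g → θ (f ⊛ g) ≋ θ f ⊛ g ⊕ f ⊛ θ g
θ-Leibniz f g n k = begin
  + n * (f ⊛ g) n k
    ≡⟨ cong (+ n *_) (⊛-coeff f g n k) ⟩
  + n * ∑[ i < suc n ] ∑[ j < suc k ] (f i j * g (n ∸ i) (k ∸ j))
    ≡⟨ ∑-*ˡ (suc n) (+ n) _ ⟩
  ∑[ i < suc n ] (+ n * ∑[ j < suc k ] (f i j * g (n ∸ i) (k ∸ j)))
    ≡⟨ ∑-cong (suc n) (λ i i<1+n → trans (∑-*ˡ (suc k) (+ n) _)
                                         (∑-cong′ (suc k) λ j → split i j (ℕ.m<1+n⇒m≤n i<1+n))) ⟩
  ∑[ i < suc n ] ∑[ j < suc k ] ((+ i * f i j) * g (n ∸ i) (k ∸ j) + f i j * (+ (n ∸ i) * g (n ∸ i) (k ∸ j)))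
    ≡⟨ ∑-cong′ (suc n) (λ i → ∑-+ (suc k) _ _) ⟩
  ∑[ i < suc n ] (∑[ j < suc k ] ((+ i * f i j) * g (n ∸ i) (k ∸ j))
                  + ∑[ j < suc k ] (f i j * (+ (n ∸ i) * g (n ∸ i) (k ∸ j))))
    ≡⟨ ∑-+ (suc n) _ _ ⟩
  ∑[ i < suc n ] ∑[ j < suc k ] ((+ i * f i j) * g (n ∸ i) (k ∸ j))
    + ∑[ i < suc n ] ∑[ j < suc k ] (f i j * (+ (n ∸ i) * g (n ∸ i) (k ∸ j)))
    ≡⟨ cong₂ _+_ (⊛-coeff (θ f) g n k) (⊛-coeff f (θ g) n k) ⟨
  (θ f ⊛ g ⊕ f ⊛ θ g) n k
    ∎
  where
  open ≡-Reasoning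
  split : ∀ i j → i ℕ.≤ n → + n * (f i j * g (n ∸ i) (k ∸ j))
                          ≡ (+ i * f i j) * g (n ∸ i) (k ∸ j) + f i j * (+ (n ∸ i) * g (n ∸ i) (k ∸ j))
  split i j i≤n = begin
    + n * (a * b)                       ≡⟨ cong (λ m → + m * (a * b)) (ℕ.m+[n∸m]≡n i≤n) ⟨
    (+ i + + (n ∸ i)) * (a * b)         ≡⟨ ℤ.*-distribʳ-+ (a * b) (+ i) (+ (n ∸ i)) ⟩
    + i * (a * b) + + (n ∸ i) * (a * b) ≡⟨ cong₂ _+_ (ℤ.*-assoc (+ i) a b) (x*[y*z]≡y*[x*z] a (+ (n ∸ i)) b) ⟨
    (+ i * a) * b + a * (+ (n ∸ i) * b) ∎
    where
    a = f i j
    b = g (n ∸ i) (k ∸ j)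

θ-X : θ X ≋ X
θ-X zero          k       = refl
θ-X (suc zero)    zero    = refl
θ-X (suc zero)    (suc k) = refl
θ-X (suc (suc n)) k       = ℤ.*-zeroʳ (+ suc (suc n))

θ-Uv : θ Uv ≋ 0ₛ
θ-Uv zero    zero          = refl
θ-Uv zero    (suc zero)    = refl
θ-Uv zero    (suc (suc k)) = refl
θ-Uv (suc n) k             = ℤ.*-zeroʳ (+ suc n)

∂x-X⊛ : ∀ f → ∂x (X ⊛ f) ≋ θ f ⊕ f
∂x-X⊛ f n k = trans (cong (+ suc n *_) (X⊛-suc f n k))
                    (trans (ℤ.suc-* (+ n) (f n k)) (ℤ.+-comm (f n k) _))

-- Vanishing principles

infix 4 X^_∣_

X^_∣_ : ℕ → Series → Set
X^ N ∣ f = ∀ n → n ℕ.< N → ∀ k → f n k ≡ +0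

X^∣-≋ : ∀ {N f g} → f ≋ g → X^ N ∣ g → X^ N ∣ f
X^∣-≋ f≋g N∣g n n<N k = trans (f≋g n k) (N∣g n n<N k)

X^∣-⊕ : ∀ {N f g} → X^ N ∣ f → X^ N ∣ g → X^ N ∣ f ⊕ g
X^∣-⊕ N∣f N∣g n n<N k = cong₂ _+_ (N∣f n n<N k) (N∣g n n<N k)

X^∣-neg : ∀ {N f} → X^ N ∣ f → X^ N ∣ -ₛ f
X^∣-neg N∣f n n<N k = cong -_ (N∣f n n<N k)

X^∣-⊛ : ∀ {N f} g → X^ N ∣ f → X^ N ∣ g ⊛ f
X^∣-⊛ {N} {f} g N∣f n n<N k = trans (⊛-coeff g f n k)
  (∑-zero (suc n) λ i _ → ∑-zero (suc k) λ j _ →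
     trans (cong (g i j *_) (N∣f (n ∸ i) (ℕ.≤-<-trans (ℕ.m∸n≤m n i) n<N) (k ∸ j))) (ℤ.*-zeroʳ (g i j)))

X^∣-X⊛ : ∀ {N f} → X^ N ∣ f → X^ suc N ∣ X ⊛ f
X^∣-X⊛ {f = f} N∣f zero    _         k = X⊛-zero f k
X^∣-X⊛ {f = f} N∣f (suc n) (s≤s n<N) k = trans (X⊛-suc f n k) (N∣f n n<N k)

≋0ₛ-by-X-recursion : ∀ {I : Set} (e V : I → Series) → (∀ h → e h ≋ X ⊛ V h) →
  (∀ {N} → (∀ h → X^ N ∣ e h) → ∀ h → X^ N ∣ V h) → ∀ h → e h ≋ 0ₛ
≋0ₛ-by-X-recursion e V e≋XV inherit h n k = divisible (suc n) h n (ℕ.n<1+n n) k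
  where
  divisible : ∀ N h → X^ N ∣ e h
  divisible zero    h n ()
  divisible (suc N) h = X^∣-≋ (e≋XV h) (X^∣-X⊛ (inherit (divisible N) h))

⊛-coeff-lowest : ∀ d s n k → (∀ i j → i ℕ.+ j ℕ.< n ℕ.+ k → d i j ≡ +0) →
                      (d ⊛ s) n k ≡ d n k * s 0 0
⊛-coeff-lowest d s n k lower = begin
  (d ⊛ s) n k
    ≡⟨ ⊛-coeff d s n k ⟩
  ∑[ i < suc n ] ∑[ j < suc k ] (d i j * s (n ∸ i) (k ∸ j))
    ≡⟨ ∑-single (suc n) n _ (ℕ.n<1+n n) (λ i i<1+n i≢n → ∑-zero (suc k) λ j j<1+k →
         cong (_* s (n ∸ i) (k ∸ j)) (lower i j (ℕ.+-mono-<-≤ (ℕ.≤∧≢⇒< (ℕ.m<1+n⇒m≤n i<1+n) i≢n)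
                                                               (ℕ.m<1+n⇒m≤n j<1+k)))) ⟩
  ∑[ j < suc k ] (d n j * s (n ∸ n) (k ∸ j))
    ≡⟨ ∑-single (suc k) k _ (ℕ.n<1+n k) (λ j j<1+k j≢k →
         cong (_* s (n ∸ n) (k ∸ j)) (lower n j (ℕ.+-monoʳ-< n (ℕ.≤∧≢⇒< (ℕ.m<1+n⇒m≤n j<1+k) j≢k)))) ⟩
  d n k * s (n ∸ n) (k ∸ k)
    ≡⟨ cong₂ (λ a b → d n k * s a b) (ℕ.n∸n≡0 n) (ℕ.n∸n≡0 k) ⟩
  d n k * s 0 0
    ∎
  where open ≡-Reasoning

-- Induction on the total degree n + k: the lowest nonzero coefficient of d would survive in d ⊛ s.
⊛⊖≋0ₛ⇒≋0ₛ : ∀ {d s} → ¬ s 0 0 ≡ +0 → d ⊛ s ≋ 0ₛ → d ≋ 0ₛ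
⊛⊖≋0ₛ⇒≋0ₛ {d} {s} s₀₀≢0 ds≋0 n k = below (suc (n ℕ.+ k)) n k (ℕ.n<1+n _)
  where
  below : ∀ N n k → n ℕ.+ k ℕ.< N → d n k ≡ +0
  below (suc N) n k (s≤s n+k≤N) =
    [ id , ⊥-elim ∘ s₀₀≢0 ]′ (ℤ.i*j≡0⇒i≡0∨j≡0 (d n k)
      (trans (sym (⊛-coeff-lowest d s n k λ i j i+j<n+k → below N i j (ℕ.<-≤-trans i+j<n+k n+k≤N)))
             (ds≋0 n k)))

square-root-unique : ∀ {S T} → S ⊛ S ≋ T ⊛ T → ¬ S 0 0 + T 0 0 ≡ +0 → S ≋ T
square-root-unique {S} {T} SS≋TT S₀₀+T₀₀≢0 n k = ℤ.i-j≡0⇒i≡j (S n k) (T n k) (difference≋0 n k)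
  where
  product≋0 : (S ⊖ T) ⊛ (S ⊕ T) ≋ 0ₛ
  product≋0 n k = trans (difference-of-squares n k)
    (trans (cong (_- (T ⊛ T) n k) (SS≋TT n k)) (ℤ.+-inverseʳ ((T ⊛ T) n k)))
    where
    difference-of-squares : (S ⊖ T) ⊛ (S ⊕ T) ≋ S ⊛ S ⊖ T ⊛ T
    difference-of-squares = solve 2 (λ s t → (s :- t) :* (s :+ t) := s :* s :- t :* t) refl S T
  difference≋0 : S ⊖ T ≋ 0ₛ
  difference≋0 = ⊛⊖≋0ₛ⇒≋0ₛ S₀₀+T₀₀≢0 product≋0

-- Path generating functions by starting height

inMFrom : ℕ → ℕ → {n : ℕ} → Vec Step n → Bool
inMFrom h k w = validFrom h w ∧ (countUO₁ w ℕ.≡ᵇ k)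

Weight : Set
Weight = ∀ {n} → Vec Step n → ℤ

-- [xⁿ uᵏ] weightedPaths h g is the total g-weight of the paths of length n from height h
-- down to the axis with k steps U or O₁; for h = 0 these are the paths of M_{n,k}.
weightedPaths : ℕ → Weight → Series
weightedPaths h g n k = sumMap (λ w → if inMFrom h k w then g w else +0) (allWords n)

down : (ℕ → Series) → ℕ → Series
down F zero    = const +0
down F (suc h) = F h

δ : ℕ → Series
δ zero    = 𝟙
δ (suc h) = const +0

weightedTails : Weight → Step → ℕ → Series
weightedTails g s h = weightedPaths h (λ w → g (s ∷ w))

weightedPaths-suc : ∀ h (g : Weight) n k → weightedPaths h g (suc n) k ≡
  (Uv ⊛ weightedTails g U (suc h)) n k
    + (down (weightedTails g D) h n k + ((Uv ⊛ weightedTails g O₁ h) n k + weightedTails g O₂ h n k))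
weightedPaths-suc h g n k =
  trans (sumMap-concatMap (term h k) (λ s → List.map (s ∷_) (allWords n)) allSteps)
  (cong₂ _+_ (trans (byFirst U) (afterU k))
  (cong₂ _+_ (trans (byFirst D) (afterD h))
  (cong₂ _+_ (trans (byFirst O₁) (afterO₁ k))
             (trans (cong (_+ +0) (byFirst O₂)) (ℤ.+-identityʳ _)))))
  where
  term : ℕ → ℕ → Vec Step (suc n) → ℤ
  term h k w = if inMFrom h k w then g w else +0
  byFirst : ∀ s → sumMap (term h k) (List.map (s ∷_) (allWords n))
                ≡ sumMap (λ w → term h k (s ∷ w)) (allWords n)
  byFirst s = cong listSum (sym (List.map-∘ (allWords n)))
  ∧false : ∀ b x → (if b ∧ false then x else +0) ≡ +0
  ∧false b x rewrite ∧-zeroʳ b = refl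
  afterU : ∀ k → sumMap (λ w → term h k (U ∷ w)) (allWords n) ≡ (Uv ⊛ weightedTails g U (suc h)) n k
  afterU zero    = trans (sumMap-zero (allWords n) λ w → ∧false (validFrom (suc h) w) _)
                         (sym (Uv⊛-zero (weightedTails g U (suc h)) n))
  afterU (suc k) = sym (Uv⊛-suc (weightedTails g U (suc h)) n k)
  afterD : ∀ h → sumMap (λ w → term h k (D ∷ w)) (allWords n) ≡ down (weightedTails g D) h n k
  afterD zero    = trans (sumMap-zero (allWords n) λ _ → refl) (sym (const-+0 n k))
  afterD (suc h) = refl
  afterO₁ : ∀ k → sumMap (λ w → term h k (O₁ ∷ w)) (allWords n) ≡ (Uv ⊛ weightedTails g O₁ h) n k
  afterO₁ zero    = trans (sumMap-zero (allWords n) λ w → ∧false (validFrom h w) _)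
                          (sym (Uv⊛-zero (weightedTails g O₁ h) n))
  afterO₁ (suc k) = sym (Uv⊛-suc (weightedTails g O₁ h) n k)

𝓜[_] : ℕ → Series
𝓜[ h ] = weightedPaths h (λ _ → + 1)

𝐌[_] : ℕ → Series
𝐌[ h ] = weightedPaths h (λ w → + areaFrom h w)

afterFirstStep : (ℕ → Series) → ℕ → Series
afterFirstStep F h = Uv ⊛ F (suc h) ⊕ (down F h ⊕ (Uv ⊛ F h ⊕ F h))

𝓜[]-firstStep : ∀ h → 𝓜[ h ] ≋ δ h ⊕ X ⊛ afterFirstStep 𝓜[_] h
𝓜[]-firstStep h zero    k =
  trans (emptyPath h k) (cong (_+_ (δ h 0 k)) (sym (X⊛-zero (afterFirstStep 𝓜[_] h) k)))
  where
  emptyPath : ∀ h k → 𝓜[ h ] 0 k ≡ δ h 0 k + +0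
  emptyPath zero    zero    = refl
  emptyPath zero    (suc k) = refl
  emptyPath (suc h) zero    = refl
  emptyPath (suc h) (suc k) = refl
𝓜[]-firstStep h (suc n) k =
  trans (weightedPaths-suc h (λ _ → + 1) n k)
        (sym (trans (cong₂ _+_ (δ-suc h) (X⊛-suc (afterFirstStep 𝓜[_] h) n k)) (ℤ.+-identityˡ _)))
  where
  δ-suc : ∀ h → δ h (suc n) k ≡ +0
  δ-suc zero    = refl
  δ-suc (suc h) = refl

tailArea : ℕ → Weight
tailArea h []      = +0
tailArea h (s ∷ w) = + areaFrom (stepH s h) w

𝐌[]-split : ∀ h → 𝐌[ h ] ≋ const (+ h) ⊛ 𝓜[ h ] ⊕ weightedPaths h (tailArea h)
𝐌[]-split h n k = begin
  𝐌[ h ] n k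
    ≡⟨ sumMap-cong (allWords n) (λ w → split (inMFrom h k w) w) ⟩
  sumMap (λ w → + h * (if inMFrom h k w then + 1 else +0) + (if inMFrom h k w then tailArea h w else +0))
         (allWords n)
    ≡⟨ sumMap-affine (+ h) _ _ (allWords n) ⟩
  + h * 𝓜[ h ] n k + weightedPaths h (tailArea h) n k
    ≡⟨ cong (_+ weightedPaths h (tailArea h) n k) (const-⊛ (+ h) 𝓜[ h ] n k) ⟨
  (const (+ h) ⊛ 𝓜[ h ] ⊕ weightedPaths h (tailArea h)) n k
    ∎
  where
  open ≡-Reasoning
  area≡h+tailArea : ∀ {n} (w : Vec Step n) → + areaFrom h w ≡ + h * + 1 + tailArea h w
  area≡h+tailArea []      = sym (trans (ℤ.+-identityʳ (+ h * + 1)) (ℤ.*-identityʳ (+ h)))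
  area≡h+tailArea (s ∷ w) = cong (_+ + areaFrom (stepH s h) w) (sym (ℤ.*-identityʳ (+ h)))
  split : ∀ b {n} (w : Vec Step n) → (if b then + areaFrom h w else +0)
                                   ≡ + h * (if b then + 1 else +0) + (if b then tailArea h w else +0)
  split true  w = area≡h+tailArea w
  split false w = sym (trans (ℤ.+-identityʳ (+ h * +0)) (ℤ.*-zeroʳ (+ h)))

tailArea-firstStep : ∀ h → weightedPaths h (tailArea h) ≋ X ⊛ afterFirstStep 𝐌[_] h
tailArea-firstStep h zero    k = trans (emptyPath (inMFrom h k [])) (sym (X⊛-zero (afterFirstStep 𝐌[_] h) k))
  where
  emptyPath : ∀ b → (if b then +0 else +0) + +0 ≡ +0
  emptyPath true  = refl
  emptyPath false = refl
tailArea-firstStep h (suc n) k =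
  trans (weightedPaths-suc h (tailArea h) n k)
  (trans (cong (λ d → (Uv ⊛ 𝐌[ suc h ]) n k + (d + (Uv ⊛ 𝐌[ h ] ⊕ 𝐌[ h ]) n k)) (afterD h))
         (sym (X⊛-suc (afterFirstStep 𝐌[_] h) n k)))
  where
  afterD : ∀ h → down (weightedTails (tailArea h) D) h n k ≡ down 𝐌[_] h n k
  afterD zero    = refl
  afterD (suc h) = refl

𝐌[]-firstStep : ∀ h → 𝐌[ h ] ≋ const (+ h) ⊛ 𝓜[ h ] ⊕ X ⊛ afterFirstStep 𝐌[_] h
𝐌[]-firstStep h n k =
  trans (𝐌[]-split h n k) (cong (_+_ ((const (+ h) ⊛ 𝓜[ h ]) n k)) (tailArea-firstStep h n k))

𝓜≋𝓜[0] : 𝓜 ≋ 𝓜[ 0 ]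
𝓜≋𝓜[0] n k = +length-filter (inM n k) (allWords n)

𝐌≋𝐌[0] : 𝐌 ≋ 𝐌[ 0 ]
𝐌≋𝐌[0] n k = +sum-filter (inM n k) area (allWords n)

-- First-passage decompositions

defectRecursion : (ℕ → Series) → ℕ → Series
defectRecursion e h =
  Uv ⊛ e (suc h) ⊕ (𝟙 ⊕ Uv) ⊛ e h ⊕ Uv ⊛ X ⊛ 𝓜[ 0 ] ⊛ e h ⊕ -ₛ (Uv ⊛ X ⊛ 𝓜[ h ] ⊛ e 0)

defects-vanish : ∀ e → (∀ h → e h ≋ X ⊛ defectRecursion e h) → ∀ h → e h ≋ 0ₛ
defects-vanish e e≋X⊛ = ≋0ₛ-by-X-recursion e (defectRecursion e) e≋X⊛ λ X^N∣e h →
  X^∣-⊕ (X^∣-⊕ (X^∣-⊕ (X^∣-⊛ Uv (X^N∣e (suc h))) (X^∣-⊛ (𝟙 ⊕ Uv) (X^N∣e h)))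
                (X^∣-⊛ (Uv ⊛ X ⊛ 𝓜[ 0 ]) (X^N∣e h)))
        (X^∣-neg (X^∣-⊛ (Uv ⊛ X ⊛ 𝓜[ h ]) (X^N∣e 0)))

⊖≋0ₛ⇒≋ : ∀ {f g} → f ⊖ g ≋ 0ₛ → f ≋ g
⊖≋0ₛ⇒≋ {f} {g} f-g≋0 n k = ℤ.i-j≡0⇒i≡j (f n k) (g n k) (f-g≋0 n k)

𝓜[]-firstPassage : ∀ h → 𝓜[ suc h ] ≋ X ⊛ 𝓜[ 0 ] ⊛ 𝓜[ h ]
𝓜[]-firstPassage h = ⊖≋0ₛ⇒≋ (defects-vanish defect defect-recursion h)
  where
  defect : ℕ → Series
  defect h = 𝓜[ suc h ] ⊖ X ⊛ 𝓜[ 0 ] ⊛ 𝓜[ h ]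
  defect-recursion : ∀ h → defect h ≋ X ⊛ defectRecursion defect h
  defect-recursion h = by-combination
    (solve 7 (λ x u f₀ f₁ fₕ fₕ₊₁ fₕ₊₂ →
       let e₀ = f₁ :- x :* f₀ :* f₀
           eₕ = fₕ₊₁ :- x :* f₀ :* fₕ
           eₕ₊₁ = fₕ₊₂ :- x :* f₀ :* fₕ₊₁
       in eₕ := x :* (u :* eₕ₊₁ :+ (con (+ 1) :+ u) :* eₕ :+ u :* x :* f₀ :* eₕ :+ :- (u :* x :* fₕ :* e₀))
                :+ (con (+ 1) :* (fₕ₊₁ :- (con +0 :+ x :* (u :* fₕ₊₂ :+ (fₕ :+ (u :* fₕ₊₁ :+ fₕ₊₁)))))
                    :+ :- (x :* fₕ) :* (f₀ :- (con (+ 1) :+ x :* (u :* f₁ :+ (con +0 :+ (u :* f₀ :+ f₀)))))))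
       refl X Uv 𝓜[ 0 ] 𝓜[ 1 ] 𝓜[ h ] 𝓜[ suc h ] 𝓜[ suc (suc h) ])
    (𝟙 · 𝓜[]-firstStep (suc h) ∷ [ -ₛ (X ⊛ 𝓜[ h ]) · 𝓜[]-firstStep 0 ])

quadraticTerm : Series → Series
quadraticTerm f = (𝟙 ⊕ Uv) ⊛ f ⊕ Uv ⊛ (X ⊛ (f ⊛ f))

𝓜[0]-quadratic : 𝓜[ 0 ] ≋ 𝟙 ⊕ X ⊛ quadraticTerm 𝓜[ 0 ]
𝓜[0]-quadratic = by-combination
  (solve 4 (λ x u f₀ f₁ →
     f₀ := con (+ 1) :+ x :* ((con (+ 1) :+ u) :* f₀ :+ u :* (x :* (f₀ :* f₀)))
           :+ (con (+ 1) :* (f₀ :- (con (+ 1) :+ x :* (u :* f₁ :+ (con +0 :+ (u :* f₀ :+ f₀)))))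
               :+ (x :* u) :* (f₁ :- x :* f₀ :* f₀)))
     refl X Uv 𝓜[ 0 ] 𝓜[ 1 ])
  (𝟙 · 𝓜[]-firstStep 0 ∷ [ X ⊛ Uv · 𝓜[]-firstPassage 0 ])

θ-X⊛ : ∀ f → θ (X ⊛ f) ≋ X ⊛ f ⊕ X ⊛ θ f
θ-X⊛ f = ≋-trans (θ-Leibniz X f) (⊕-cong (⊛-congʳ f θ-X) ≋-refl)

θ-⊛-free : ∀ {c} f → θ c ≋ 0ₛ → θ (c ⊛ f) ≋ c ⊛ θ f
θ-⊛-free {c} f θc≋0 = begin
  θ (c ⊛ f)          ≈⟨ θ-Leibniz c f ⟩
  θ c ⊛ f ⊕ c ⊛ θ f  ≈⟨ ⊕-cong (⊛-congʳ f θc≋0) ≋-refl ⟩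
  0ₛ ⊛ f ⊕ c ⊛ θ f   ≈⟨ ⊕-cong (⊛-zeroˡ f) ≋-refl ⟩
  0ₛ ⊕ c ⊛ θ f       ≈⟨ ⊕-identityˡ (c ⊛ θ f) ⟩
  c ⊛ θ f            ∎
  where open SetoidReasoning setoid

θ-quadraticTerm : ∀ f → θ (quadraticTerm f) ≋ (𝟙 ⊕ Uv) ⊛ θ f ⊕ Uv ⊛ (X ⊛ (f ⊛ f) ⊕ X ⊛ (θ f ⊛ f ⊕ f ⊛ θ f))
θ-quadraticTerm f = begin
  θ ((𝟙 ⊕ Uv) ⊛ f ⊕ Uv ⊛ (X ⊛ (f ⊛ f)))
    ≈⟨ θ-⊕ ((𝟙 ⊕ Uv) ⊛ f) (Uv ⊛ (X ⊛ (f ⊛ f))) ⟩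
  θ ((𝟙 ⊕ Uv) ⊛ f) ⊕ θ (Uv ⊛ (X ⊛ (f ⊛ f)))
    ≈⟨ ⊕-cong (θ-⊛-free f θ[𝟙⊕Uv]≋0) (θ-⊛-free (X ⊛ (f ⊛ f)) θ-Uv) ⟩
  (𝟙 ⊕ Uv) ⊛ θ f ⊕ Uv ⊛ θ (X ⊛ (f ⊛ f))
    ≈⟨ ⊕-congˡ ((𝟙 ⊕ Uv) ⊛ θ f) (⊛-congˡ Uv (θ-X⊛ (f ⊛ f))) ⟩
  (𝟙 ⊕ Uv) ⊛ θ f ⊕ Uv ⊛ (X ⊛ (f ⊛ f) ⊕ X ⊛ θ (f ⊛ f))
    ≈⟨ ⊕-congˡ ((𝟙 ⊕ Uv) ⊛ θ f) (⊛-congˡ Uv (⊕-congˡ (X ⊛ (f ⊛ f)) (⊛-congˡ X (θ-Leibniz f f)))) ⟩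
  (𝟙 ⊕ Uv) ⊛ θ f ⊕ Uv ⊛ (X ⊛ (f ⊛ f) ⊕ X ⊛ (θ f ⊛ f ⊕ f ⊛ θ f))
    ∎
  where
  open SetoidReasoning setoid
  θ[𝟙⊕Uv]≋0 : θ (𝟙 ⊕ Uv) ≋ 0ₛ
  θ[𝟙⊕Uv]≋0 n k = trans (θ-⊕ 𝟙 Uv n k) (cong₂ _+_ (θ-𝟙 n k) (θ-Uv n k))

θ𝓜[0] : θ 𝓜[ 0 ] ≋ X ⊛ quadraticTerm 𝓜[ 0 ] ⊕ X ⊛ θ (quadraticTerm 𝓜[ 0 ])
θ𝓜[0] = begin
  θ 𝓜[ 0 ]                                         ≈⟨ θ-cong 𝓜[0]-quadratic ⟩
  θ (𝟙 ⊕ X ⊛ T)                                   ≈⟨ θ-⊕ 𝟙 (X ⊛ T) ⟩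
  θ 𝟙 ⊕ θ (X ⊛ T)                                 ≈⟨ ⊕-cong θ-𝟙 (θ-X⊛ T) ⟩
  0ₛ ⊕ (X ⊛ T ⊕ X ⊛ θ T)                          ≈⟨ ⊕-identityˡ (X ⊛ T ⊕ X ⊛ θ T) ⟩
  X ⊛ T ⊕ X ⊛ θ T                                 ∎
  where
  open SetoidReasoning setoid
  T = quadraticTerm 𝓜[ 0 ]

∂[x𝓜] : Series
∂[x𝓜] = θ 𝓜[ 0 ] ⊕ 𝓜[ 0 ]

√Δ : Series
√Δ = 𝟙 ⊖ X ⊛ ((𝟙 ⊕ Uv) ⊕ const (+ 2) ⊛ Uv ⊛ X ⊛ 𝓜[ 0 ])

-- Apply θ to the quadratic equation.
∂[x𝓜]⊛√Δ≋𝓜[0] : ∂[x𝓜] ⊛ √Δ ≋ 𝓜[ 0 ]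
∂[x𝓜]⊛√Δ≋𝓜[0] = by-combination
  (solve 5 (λ x u f θf θt →
     let T = (con (+ 1) :+ u) :* f :+ u :* (x :* (f :* f))
     in (θf :+ f) :* (con (+ 1) :- x :* ((con (+ 1) :+ u) :+ con (+ 2) :* u :* x :* f))
          := f :+ (con (+ 1) :* (θf :- (x :* T :+ x :* θt))
                   :+ x :* (θt :- ((con (+ 1) :+ u) :* θf
                                   :+ u :* (x :* (f :* f) :+ x :* (θf :* f :+ f :* θf))))))
     refl X Uv 𝓜[ 0 ] (θ 𝓜[ 0 ]) (θ (quadraticTerm 𝓜[ 0 ])))
  (𝟙 · θ𝓜[0] ∷ [ X · θ-quadraticTerm 𝓜[ 0 ] ])

√Δ⊛√Δ≋Δ : √Δ ⊛ √Δ ≋ Δ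
√Δ⊛√Δ≋Δ = by-combination
  (solve 3 (λ x u f →
     let r = con (+ 1) :- x :* ((con (+ 1) :+ u) :+ con (+ 2) :* u :* x :* f)
     in r :* r := (u :- con (+ 1)) :* (u :- con (+ 1)) :* x :* x
                    :- con (+ 2) :* (u :+ con (+ 1)) :* x :+ con (+ 1)
                  :+ con (- + 4) :* u :* x :* x
                     :* (f :- (con (+ 1) :+ x :* ((con (+ 1) :+ u) :* f :+ u :* (x :* (f :* f))))))
     refl X Uv 𝓜[ 0 ])
  [ const (- + 4) ⊛ Uv ⊛ X ⊛ X · 𝓜[0]-quadratic ]

√Δ₀₀ : √Δ 0 0 ≡ + 1
√Δ₀₀ = cong (_-_ (+ 1)) (X⊛-zero ((𝟙 ⊕ Uv) ⊕ const (+ 2) ⊛ Uv ⊛ X ⊛ 𝓜[ 0 ]) 0)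

const-suc : ∀ h → const (+ suc h) ≋ const (+ h) ⊕ 𝟙
const-suc h zero    zero    = cong +_ (ℕ.+-comm 1 h)
const-suc h zero    (suc k) = refl
const-suc h (suc n) k       = refl

𝐌[]-firstPassage : ∀ h →
  𝐌[ suc h ] ≋ X ⊛ (𝐌[ 0 ] ⊛ 𝓜[ h ] ⊕ 𝓜[ 0 ] ⊛ 𝐌[ h ] ⊕ (const (+ h) ⊕ 𝟙) ⊛ ∂[x𝓜] ⊛ 𝓜[ h ])
𝐌[]-firstPassage h = ⊖≋0ₛ⇒≋ (defects-vanish defect defect-recursion h)
  where
  defect : ℕ → Series
  defect h = 𝐌[ suc h ] ⊖ X ⊛ (𝐌[ 0 ] ⊛ 𝓜[ h ] ⊕ 𝓜[ 0 ] ⊛ 𝐌[ h ] ⊕ (const (+ h) ⊕ 𝟙) ⊛ ∂[x𝓜] ⊛ 𝓜[ h ])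
  defect-recursion : ∀ h → defect h ≋ X ⊛ defectRecursion defect h
  defect-recursion h = by-combination
    (solve 13 (λ x u c c₊ f₀ fₕ fₕ₊₁ a₀ a₁ aₕ aₕ₊₁ aₕ₊₂ ℓ →
       let r = con (+ 1) :- x :* ((con (+ 1) :+ u) :+ con (+ 2) :* u :* x :* f₀)
           e₀ = a₁ :- x :* (a₀ :* f₀ :+ f₀ :* a₀ :+ (con +0 :+ con (+ 1)) :* ℓ :* f₀)
           eₕ = aₕ₊₁ :- x :* (a₀ :* fₕ :+ f₀ :* aₕ :+ (c :+ con (+ 1)) :* ℓ :* fₕ)
           eₕ₊₁ = aₕ₊₂ :- x :* (a₀ :* fₕ₊₁ :+ f₀ :* aₕ₊₁ :+ (c₊ :+ con (+ 1)) :* ℓ :* fₕ₊₁)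
       in eₕ := x :* (u :* eₕ₊₁ :+ (con (+ 1) :+ u) :* eₕ :+ u :* x :* f₀ :* eₕ :+ :- (u :* x :* fₕ :* e₀))
                :+ (con (+ 1) :* (aₕ₊₁ :- (c₊ :* fₕ₊₁ :+ x :* (u :* aₕ₊₂ :+ (aₕ :+ (u :* aₕ₊₁ :+ aₕ₊₁)))))
                :+ (:- (x :* aₕ)
                      :* (f₀ :- (con (+ 1) :+ x :* ((con (+ 1) :+ u) :* f₀ :+ u :* (x :* (f₀ :* f₀)))))
                :+ (:- (x :* fₕ) :* (a₀ :- (con +0 :* f₀ :+ x :* (u :* a₁ :+ (con +0 :+ (u :* a₀ :+ a₀)))))
                :+ (:- ((c :+ con (+ 1)) :* x :* fₕ) :* (ℓ :* r :- f₀)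
                :+ ((c₊ :+ c₊ :* ℓ :* u :* x :* x :+ ℓ :* u :* x :* x :+ a₀ :* u :* x :* x)
                      :* (fₕ₊₁ :- x :* f₀ :* fₕ)
                :+ (x :* f₀ :* fₕ :* (con (+ 1) :+ ℓ :* u :* x :* x)) :* (c₊ :- (c :+ con (+ 1)))))))))
       refl X Uv (const (+ h)) (const (+ suc h)) 𝓜[ 0 ] 𝓜[ h ] 𝓜[ suc h ]
              𝐌[ 0 ] 𝐌[ 1 ] 𝐌[ h ] 𝐌[ suc h ] 𝐌[ suc (suc h) ] ∂[x𝓜])
    (𝟙 · 𝐌[]-firstStep (suc h)
     ∷ -ₛ (X ⊛ 𝐌[ h ]) · 𝓜[0]-quadratic
     ∷ -ₛ (X ⊛ 𝓜[ h ]) · 𝐌[]-firstStep 0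
     ∷ -ₛ ((const (+ h) ⊕ 𝟙) ⊛ X ⊛ 𝓜[ h ]) · ∂[x𝓜]⊛√Δ≋𝓜[0]
     ∷ (const (+ suc h) ⊕ const (+ suc h) ⊛ ∂[x𝓜] ⊛ Uv ⊛ X ⊛ X ⊕ ∂[x𝓜] ⊛ Uv ⊛ X ⊛ X ⊕ 𝐌[ 0 ] ⊛ Uv ⊛ X ⊛ X)
         · 𝓜[]-firstPassage h
     ∷ [ X ⊛ 𝓜[ 0 ] ⊛ 𝓜[ h ] ⊛ (𝟙 ⊕ ∂[x𝓜] ⊛ Uv ⊛ X ⊛ X) · const-suc h ])

𝐌[0]-functionalEquation :
  𝐌[ 0 ] ≋ X ⊛ (𝟙 ⊕ Uv) ⊛ 𝐌[ 0 ] ⊕ Uv ⊛ X ⊛ X ⊛ (const (+ 2) ⊛ 𝓜[ 0 ] ⊛ 𝐌[ 0 ] ⊕ 𝓜[ 0 ] ⊛ ∂[x𝓜])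
𝐌[0]-functionalEquation = by-combination
  (solve 6 (λ x u f₀ a₀ a₁ ℓ →
     a₀ := x :* (con (+ 1) :+ u) :* a₀ :+ u :* x :* x :* (con (+ 2) :* f₀ :* a₀ :+ f₀ :* ℓ)
           :+ (con (+ 1) :* (a₀ :- (con +0 :* f₀ :+ x :* (u :* a₁ :+ (con +0 :+ (u :* a₀ :+ a₀)))))
               :+ (x :* u) :* (a₁ :- x :* (a₀ :* f₀ :+ f₀ :* a₀ :+ (con +0 :+ con (+ 1)) :* ℓ :* f₀))))
     refl X Uv 𝓜[ 0 ] 𝐌[ 0 ] 𝐌[ 1 ] ∂[x𝓜])
  (𝟙 · 𝐌[]-firstStep 0 ∷ [ X ⊛ Uv · 𝐌[]-firstPassage 0 ])

𝐌[0]-closedForm : const (+ 2) ⊛ Uv ⊛ X ⊛ X ⊛ Δ ⊛ 𝐌[ 0 ]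
                    ≋ (Uv ⊛ Uv ⊕ 𝟙) ⊛ X ⊛ X ⊖ (Uv ⊕ 𝟙) ⊛ X ⊕ ((Uv ⊕ 𝟙) ⊛ X ⊖ 𝟙) ⊛ (√Δ ⊖ 𝟙)
𝐌[0]-closedForm = by-combination
  (solve 5 (λ x u f₀ a₀ ℓ →
     let r = con (+ 1) :- x :* ((con (+ 1) :+ u) :+ con (+ 2) :* u :* x :* f₀)
         c = con (+ 2) :* u :* x :* x
     in c :* ((u :- con (+ 1)) :* (u :- con (+ 1)) :* x :* x :- con (+ 2) :* (u :+ con (+ 1)) :* x :+ con (+ 1))
          :* a₀
          := (u :* u :+ con (+ 1)) :* x :* x :- (u :+ con (+ 1)) :* x
             :+ ((u :+ con (+ 1)) :* x :- con (+ 1)) :* (r :- con (+ 1))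
             :+ (c :* u :* x :* x :* f₀ :* (ℓ :* r :- f₀)
                 :+ (c :* r
                       :* (a₀ :- (x :* (con (+ 1) :+ u) :* a₀ :+ u :* x :* x :* (con (+ 2) :* f₀ :* a₀ :+ f₀ :* ℓ)))
                 :+ c :* (con (+ 4) :* u :* x :* x :* a₀ :- con (+ 1))
                       :* (f₀ :- (con (+ 1) :+ x :* ((con (+ 1) :+ u) :* f₀ :+ u :* (x :* (f₀ :* f₀))))))))
     refl X Uv 𝓜[ 0 ] 𝐌[ 0 ] ∂[x𝓜])
  (const (+ 2) ⊛ Uv ⊛ X ⊛ X ⊛ Uv ⊛ X ⊛ X ⊛ 𝓜[ 0 ] · ∂[x𝓜]⊛√Δ≋𝓜[0]
   ∷ const (+ 2) ⊛ Uv ⊛ X ⊛ X ⊛ √Δ · 𝐌[0]-functionalEquation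
   ∷ [ const (+ 2) ⊛ Uv ⊛ X ⊛ X ⊛ (const (+ 4) ⊛ Uv ⊛ X ⊛ X ⊛ 𝐌[ 0 ] ⊖ 𝟙) · 𝓜[0]-quadratic ])

∂x[X⊛𝓜]≋∂[x𝓜] : ∂x (X ⊛ 𝓜) ≋ ∂[x𝓜]
∂x[X⊛𝓜]≋∂[x𝓜] = ≋-trans (∂x-X⊛ 𝓜) (⊕-cong (θ-cong 𝓜≋𝓜[0]) 𝓜≋𝓜[0])

IsSqrtΔ⇒≋√Δ : ∀ {S} → IsSqrtΔ S → S ≋ √Δ
IsSqrtΔ⇒≋√Δ (S⊛S≋Δ , S₀₀≡1) = square-root-unique (≋-trans S⊛S≋Δ (≋-sym √Δ⊛√Δ≋Δ))
  λ S₀₀+√Δ₀₀≡0 → case trans (cong₂ _+_ (sym S₀₀≡1) (sym √Δ₀₀)) S₀₀+√Δ₀₀≡0 of λ ()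

𝐌-functionalEquation : 𝐌 ≋ X ⊛ (𝟙 ⊕ Uv) ⊛ 𝐌 ⊕ Uv ⊛ X ⊛ X ⊛ (const (+ 2) ⊛ 𝓜 ⊛ 𝐌 ⊕ 𝓜 ⊛ ∂x (X ⊛ 𝓜))
𝐌-functionalEquation = begin
  𝐌
    ≈⟨ 𝐌≋𝐌[0] ⟩
  𝐌[ 0 ]
    ≈⟨ 𝐌[0]-functionalEquation ⟩
  X ⊛ (𝟙 ⊕ Uv) ⊛ 𝐌[ 0 ] ⊕ Uv ⊛ X ⊛ X ⊛ (const (+ 2) ⊛ 𝓜[ 0 ] ⊛ 𝐌[ 0 ] ⊕ 𝓜[ 0 ] ⊛ ∂[x𝓜])
    ≈⟨ ⊕-cong (⊛-congˡ (X ⊛ (𝟙 ⊕ Uv)) 𝐌≋𝐌[0])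
              (⊛-congˡ (Uv ⊛ X ⊛ X) (⊕-cong (⊛-cong (⊛-congˡ (const (+ 2)) 𝓜≋𝓜[0]) 𝐌≋𝐌[0])
                                             (⊛-cong 𝓜≋𝓜[0] ∂x[X⊛𝓜]≋∂[x𝓜]))) ⟨
  X ⊛ (𝟙 ⊕ Uv) ⊛ 𝐌 ⊕ Uv ⊛ X ⊛ X ⊛ (const (+ 2) ⊛ 𝓜 ⊛ 𝐌 ⊕ 𝓜 ⊛ ∂x (X ⊛ 𝓜))
    ∎
  where open SetoidReasoning setoid

𝐌-closedForm : ∀ S → IsSqrtΔ S →
  const (+ 2) ⊛ Uv ⊛ X ⊛ X ⊛ Δ ⊛ 𝐌 ≋ (Uv ⊛ Uv ⊕ 𝟙) ⊛ X ⊛ X ⊖ (Uv ⊕ 𝟙) ⊛ X ⊕ ((Uv ⊕ 𝟙) ⊛ X ⊖ 𝟙) ⊛ (S ⊖ 𝟙)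
𝐌-closedForm S isSqrt = begin
  const (+ 2) ⊛ Uv ⊛ X ⊛ X ⊛ Δ ⊛ 𝐌
    ≈⟨ ⊛-congˡ (const (+ 2) ⊛ Uv ⊛ X ⊛ X ⊛ Δ) 𝐌≋𝐌[0] ⟩
  const (+ 2) ⊛ Uv ⊛ X ⊛ X ⊛ Δ ⊛ 𝐌[ 0 ]
    ≈⟨ 𝐌[0]-closedForm ⟩
  (Uv ⊛ Uv ⊕ 𝟙) ⊛ X ⊛ X ⊖ (Uv ⊕ 𝟙) ⊛ X ⊕ ((Uv ⊕ 𝟙) ⊛ X ⊖ 𝟙) ⊛ (√Δ ⊖ 𝟙)
    ≈⟨ ⊕-congˡ ((Uv ⊛ Uv ⊕ 𝟙) ⊛ X ⊛ X ⊖ (Uv ⊕ 𝟙) ⊛ X)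
               (⊛-congˡ ((Uv ⊕ 𝟙) ⊛ X ⊖ 𝟙) λ n k → cong (_- 𝟙 n k) (IsSqrtΔ⇒≋√Δ {S} isSqrt n k)) ⟨
  (Uv ⊛ Uv ⊕ 𝟙) ⊛ X ⊛ X ⊖ (Uv ⊕ 𝟙) ⊛ X ⊕ ((Uv ⊕ 𝟙) ⊛ X ⊖ 𝟙) ⊛ (S ⊖ 𝟙)
    ∎
  where open SetoidReasoning setoid

proposition3p2 :
    (𝐌 ≋ X ⊛ (𝟙 ⊕ Uv) ⊛ 𝐌
           ⊕ Uv ⊛ X ⊛ X ⊛ (const (+ 2) ⊛ 𝓜 ⊛ 𝐌 ⊕ 𝓜 ⊛ ∂x (X ⊛ 𝓜)))
    × (∀ (S : Series) → IsSqrtΔ S →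
         const (+ 2) ⊛ Uv ⊛ X ⊛ X ⊛ Δ ⊛ 𝐌
           ≋ (Uv ⊛ Uv ⊕ 𝟙) ⊛ X ⊛ X ⊖ (Uv ⊕ 𝟙) ⊛ X
             ⊕ ((Uv ⊕ 𝟙) ⊛ X ⊖ 𝟙) ⊛ (S ⊖ 𝟙))
proposition3p2 = 𝐌-functionalEquation , 𝐌-closedForm
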